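{- Let $q$ be a power of an odd prime $p$, let $n$ be a positive integer, let $\mathcal P$ be the $n\times n$ cyclic permutation matrix (entries $\mathcal P_{j,j+1}=1$ for $1\le j\le n-1$, $\mathcal P_{n,1}=1$, all other entries $0$), and let $M_{n,1}=\mathcal P^T-2\,\mathrm{Id}+\mathcal P$, viewed over $\mathbb{F}_q$. Then \[\operatorname{rank} M_{n,1}=\begin{cases} n-1 & \text{if } \gcd(n,p)=1;\\ n-2 & \text{if } \gcd(n,p)=p.\end{cases}\] Moreover, if $M'_{n,1}$ denotes the principal submatrix of $M_{n,1}$ formed by its first $\operatorname{rank}(M_{n,1})$ rows and columns, then $M'_{n,1}$ is a reduced matrix of $M_{n,1}$ and \[\det M'_{n,1}=\begin{cases} (-1)^{n-1}n & \text{if } \gcd(n,p)=1;\\ (-1)^{n-1} & \text{if } \gcd(n,p)=p.\end{cases}\]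
   Context: For symmetric matrices $U\in M_m(\mathbb{F}_q)$ and $V\in M_k(\mathbb{F}_q)$ with $k\le m$, $U$ is equivalent to $V$ if there is $M\in\mathrm{GL}_m(\mathbb{F}_q)$ with $M^TUM=\begin{pmatrix}V&0\\0&0\end{pmatrix}$; $V$ is a reduced matrix of $U$ if moreover $V$ is nonsingular. -}

module Defs where

open import Level using (Level; _⊔_)
open import Data.Nat as ℕ using (ℕ; zero; suc; _<?_; _≟_)
open import Data.Fin using (Fin; zero; suc; toℕ; fromℕ<; inject≤; punchIn)
open import Data.Bool using (Bool; true; false; if_then_else_; _∨_; _∧_)
open import Data.Product using (Σ; _×_; _,_)
open import Relation.Nullary using (¬_; yes; no)
open import Relation.Nullary.Decidable using (⌊_⌋)
open import Relation.Binary.PropositionalEquality as ≡ using (_≡_)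
open import Function.Bundles using (Inverse)
open import Algebra.Bundles using (CommutativeRing)

record IsField {c ℓ} (R : CommutativeRing c ℓ) : Set (c ⊔ ℓ) where
  open CommutativeRing R hiding (zero)
  field
    1≉0 : ¬ (1# ≈ 0#)
    inverse : ∀ x → ¬ (x ≈ 0#) → Σ Carrier λ y → x * y ≈ 1#

HasCardinality : ∀ {c ℓ} (R : CommutativeRing c ℓ) → ℕ → Set (c ⊔ ℓ)
HasCardinality R q = Inverse (CommutativeRing.setoid R) (≡.setoid (Fin q))

module MatrixDefs {c ℓ} (R : CommutativeRing c ℓ) where
  open CommutativeRing R hiding (zero)

  fromℕ : ℕ → Carrier
  fromℕ zero    = 0#
  fromℕ (suc k) = 1# + fromℕ k

  _^ᶠ_ : Carrier → ℕ → Carrier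
  x ^ᶠ zero  = 1#
  x ^ᶠ suc k = x * (x ^ᶠ k)

  ∑ : ∀ {n} → (Fin n → Carrier) → Carrier
  ∑ {zero}  f = 0#
  ∑ {suc n} f = f zero + ∑ (λ i → f (suc i))

  Matrix : ℕ → ℕ → Set c
  Matrix m k = Fin m → Fin k → Carrier

  _≈ᴹ_ : ∀ {m k} → Matrix m k → Matrix m k → Set ℓ
  A ≈ᴹ B = ∀ i j → A i j ≈ B i j

  _ᵀ : ∀ {m k} → Matrix m k → Matrix k m
  (A ᵀ) i j = A j i

  _⊕_ : ∀ {m k} → Matrix m k → Matrix m k → Matrix m k
  (A ⊕ B) i j = A i j + B i j

  _⊗_ : ∀ {m k l} → Matrix m k → Matrix k l → Matrix m l
  (A ⊗ B) i j = ∑ (λ t → A i t * B t j)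

  scale : ∀ {m k} → Carrier → Matrix m k → Matrix m k
  scale a A i j = a * A i j

  Id : ∀ {n} → Matrix n n
  Id i j = if ⌊ toℕ i ≟ toℕ j ⌋ then 1# else 0#

  Zero : ∀ {m k} → Matrix m k
  Zero i j = 0#

  det : ∀ {n} → Matrix n n → Carrier
  det {zero}  A = 1#
  det {suc n} A =
    ∑ (λ j → ((- 1#) ^ᶠ toℕ j) * (A zero j * det (λ i k → A (suc i) (punchIn j k))))

  Nonsingular : ∀ {n} → Matrix n n → Set ℓ
  Nonsingular A = ¬ (det A ≈ 0#)

  Invertible : ∀ {m} → Matrix m m → Set (c ⊔ ℓ)
  Invertible {m} A = Σ (Matrix m m) λ B → ((A ⊗ B) ≈ᴹ Id) × ((B ⊗ A) ≈ᴹ Id)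

  LinearlyIndependent : ∀ {r n} → (Fin r → Fin n → Carrier) → Set (c ⊔ ℓ)
  LinearlyIndependent {r} {n} v =
    (a : Fin r → Carrier) → (∀ i → ∑ (λ t → a t * v t i) ≈ 0#) → ∀ t → a t ≈ 0#

  InjectiveIdx : ∀ {r n} → (Fin r → Fin n) → Set
  InjectiveIdx σ = ∀ s t → σ s ≡ σ t → s ≡ t

  HasRank : ∀ {m n} → Matrix m n → ℕ → Set (c ⊔ ℓ)
  HasRank {m} {n} A r =
    (Σ (Fin r → Fin n) λ σ → InjectiveIdx σ × LinearlyIndependent (λ t i → A i (σ t)))
    × ((σ : Fin (suc r) → Fin n) → InjectiveIdx σ →
         ¬ LinearlyIndependent (λ t i → A i (σ t)))

  pad : ∀ {k} m → Matrix k k → Matrix m m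
  pad {k} m V i j with toℕ i <? k | toℕ j <? k
  ... | yes i<k | yes j<k = V (fromℕ< i<k) (fromℕ< j<k)
  ... | _       | _       = 0#

  Equivalent : ∀ {m k} → Matrix m m → Matrix k k → Set (c ⊔ ℓ)
  Equivalent {m} {k} U V =
    (k ℕ.≤ m) × Σ (Matrix m m) λ M → Invertible M × (((M ᵀ) ⊗ (U ⊗ M)) ≈ᴹ pad m V)

  IsReducedMatrix : ∀ {m k} → Matrix m m → Matrix k k → Set (c ⊔ ℓ)
  IsReducedMatrix U V = Equivalent U V × Nonsingular V

  principal : ∀ {n r} → .(r ℕ.≤ n) → Matrix n n → Matrix r r
  principal r≤n A i j = A (inject≤ i r≤n) (inject≤ j r≤n)

  -- the n×n cyclic permutation matrix: entries (j, j+1) and (n, 1) equal 1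
  -- (0-indexed: (i, i+1) for i+1 < n, and (n-1, 0))
  cyclicP : ∀ n → Matrix n n
  cyclicP n i j =
    if ⌊ suc (toℕ i) ≟ toℕ j ⌋ ∨ (⌊ suc (toℕ i) ≟ n ⌋ ∧ ⌊ toℕ j ≟ 0 ⌋)
    then 1# else 0#

  M₁ : ∀ n → Matrix n n
  M₁ n = ((cyclicP n ᵀ) ⊕ scale (- (1# + 1#)) Id) ⊕ cyclicP n

-- M_{n,1} is the second-difference operator of the n-cycle: (M F)(k) = F(k-1) - 2 F(k) + F(k+1),
-- indices mod n. Its kernel contains the constants and, when n = 0 in the field, the affine
-- functions of k. For r < n its leading r × r block is the second-difference matrix of a path,
-- of determinant (-1)^r (r+1), and a vanishing combination F of the first r columns satisfies
-- F(k) = (k+1) F(0), so these columns are independent once r + 1 ≠ 0. Take r = n - 1 if p ∤ n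
-- and r = n - 2 if p ∣ n (then r + 1 = -1). Completing e₁, …, e_r by kernel vectors gives an
-- invertible B with Bᵀ M B = (M' 0; 0 0), and the same kernel vectors make any r + 1 columns
-- dependent.
module Submission where

open import Defs
open import Data.Nat using (ℕ; _≤_; _∸_; _^_)
open import Data.Nat.Properties using (m∸n≤m)
open import Data.Nat.GCD using (gcd)
open import Data.Nat.Primality using (Prime)
open import Data.Product using (_×_)
open import Relation.Binary.PropositionalEquality using (_≡_; _≢_)
open import Algebra.Bundles using (CommutativeRing)

open import Data.Nat as ℕ using (zero; suc; _<_; _≡ᵇ_; _<?_; z≤n; s≤s)
import Data.Nat.Properties as ℕ
open import Data.Nat.Divisibility using (_∣_; divides; ∣⇒≤)
open import Data.Nat.GCD using (gcd[m,n]∣m; module Bézout)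
open import Data.Nat.Coprimality using (coprime-Bézout; gcd≡1⇒coprime)
open import Data.Nat.Primality using (prime⇒nonTrivial)
open import Data.Product using (_,_; Σ; ∃; proj₁; proj₂; uncurry)
open import Data.Sum using (_⊎_; inj₁; inj₂)
open import Data.Empty using (⊥-elim)
open import Function using (_∘_)
open import Relation.Nullary using (Dec; yes; no; ¬_)
import Relation.Binary.PropositionalEquality as ≡

-- ℤ maps into every commutative ring, so it can serve as the coefficient ring of the solver.
module IntegerCoefficients {c ℓ} (R : CommutativeRing c ℓ) where

  open import Data.Integer as ℤ using (ℤ; +_; -[1+_])
  import Data.Integer.Properties as ℤ
  open import Data.Sign as Sign using (Sign)
  open import Data.Maybe using (Maybe; just; nothing)
  open CommutativeRing R hiding (zero)
  open import Algebra.Properties.Ring ring using (-‿involutive; -0#≈0#; -1*x≈-x)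
  open import Algebra.Properties.AbelianGroup +-abelianGroup using (⁻¹-∙-comm)
  open import Algebra.Properties.Semiring.Mult.TCOptimised semiring
    using (1+×; ×-homo-+; ×1-homo-*) renaming (_×_ to _×′_)
  open import Algebra.Solver.Ring.AlmostCommutativeRing
    using (fromCommutativeRing; _-Raw-AlmostCommutative⟶_)
  open import Relation.Binary.Reasoning.Setoid setoid

  -- The optimised multiples satisfy 0 ×′ x = 0# and 1 ×′ x = x definitionally, so the
  -- solver's constants +0 and +1 are interpreted as 0# and 1# themselves.
  fromℤ : ℤ → Carrier
  fromℤ (+ n)      = n ×′ 1#
  fromℤ -[1+ n ]   = - (suc n ×′ 1#)

  fromℤ-⊖ : ∀ m n → fromℤ (m ℤ.⊖ n) ≈ m ×′ 1# - n ×′ 1#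
  fromℤ-⊖ m       zero    = sym (trans (+-congˡ -0#≈0#) (+-identityʳ _))
  fromℤ-⊖ zero    (suc n) = sym (+-identityˡ _)
  fromℤ-⊖ (suc m) (suc n) rewrite ℤ.[1+m]⊖[1+n]≡m⊖n m n = begin
    fromℤ (m ℤ.⊖ n)                       ≈⟨ fromℤ-⊖ m n ⟩
    m ×′ 1# - n ×′ 1#                     ≈⟨ +-congˡ (sym (trans (+-congʳ (-‿inverseʳ 1#))
                                                               (+-identityˡ _))) ⟩
    m ×′ 1# + ((1# - 1#) + - (n ×′ 1#))   ≈⟨ +-congˡ (+-assoc 1# (- 1#) _) ⟩
    m ×′ 1# + (1# + (- 1# + - (n ×′ 1#))) ≈⟨ +-assoc _ 1# _ ⟨
    (m ×′ 1# + 1#) + (- 1# + - (n ×′ 1#)) ≈⟨ +-cong (trans (+-comm _ _) (sym (1+× m 1#)))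
                                                    (⁻¹-∙-comm 1# _) ⟩
    suc m ×′ 1# - (1# + n ×′ 1#)          ≈⟨ +-congˡ (-‿cong (sym (1+× n 1#))) ⟩
    suc m ×′ 1# - suc n ×′ 1#             ∎

  fromℤ-+ : ∀ i j → fromℤ (i ℤ.+ j) ≈ fromℤ i + fromℤ j
  fromℤ-+ (+ m)    (+ n)    = ×-homo-+ 1# m n
  fromℤ-+ (+ m)    -[1+ n ] = fromℤ-⊖ m (suc n)
  fromℤ-+ -[1+ m ] (+ n)    = trans (fromℤ-⊖ n (suc m)) (+-comm _ _)
  fromℤ-+ -[1+ m ] -[1+ n ] = begin
    - (suc (suc (m ℕ.+ n)) ×′ 1#)      ≡⟨ ≡.cong (λ k → - (suc k ×′ 1#)) (ℕ.+-suc m n) ⟨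
    - ((suc m ℕ.+ suc n) ×′ 1#)        ≈⟨ -‿cong (×-homo-+ 1# (suc m) (suc n)) ⟩
    - (suc m ×′ 1# + suc n ×′ 1#)      ≈⟨ ⁻¹-∙-comm _ _ ⟨
    - (suc m ×′ 1#) + - (suc n ×′ 1#)  ∎

  sign : Sign → Carrier
  sign Sign.+ = 1#
  sign Sign.- = - 1#

  sign-* : ∀ s t → sign (s Sign.* t) ≈ sign s * sign t
  sign-* Sign.+ t      = sym (*-identityˡ _)
  sign-* Sign.- Sign.+ = sym (*-identityʳ _)
  sign-* Sign.- Sign.- = sym (trans (-1*x≈-x _) (-‿involutive _))

  fromℤ-◃ : ∀ s n → fromℤ (s ℤ.◃ n) ≈ sign s * (n ×′ 1#)
  fromℤ-◃ s      zero    = sym (zeroʳ _)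
  fromℤ-◃ Sign.+ (suc n) = sym (*-identityˡ _)
  fromℤ-◃ Sign.- (suc n) = sym (-1*x≈-x _)

  fromℤ-sign-abs : ∀ i → fromℤ i ≈ sign (ℤ.sign i) * (ℤ.∣ i ∣ ×′ 1#)
  fromℤ-sign-abs (+ n)    = sym (*-identityˡ _)
  fromℤ-sign-abs -[1+ n ] = sym (-1*x≈-x _)

  fromℤ-* : ∀ i j → fromℤ (i ℤ.* j) ≈ fromℤ i * fromℤ j
  fromℤ-* i j = begin
    fromℤ (i ℤ.* j)                              ≈⟨ fromℤ-◃ (s Sign.* t) (a ℕ.* b) ⟩
    sign (s Sign.* t) * ((a ℕ.* b) ×′ 1#)        ≈⟨ *-cong (sign-* s t) (×1-homo-* a b) ⟩
    (sign s * sign t) * ((a ×′ 1#) * (b ×′ 1#))  ≈⟨ interchange _ _ _ _ ⟩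
    (sign s * (a ×′ 1#)) * (sign t * (b ×′ 1#))  ≈⟨ *-cong (fromℤ-sign-abs i) (fromℤ-sign-abs j) ⟨
    fromℤ i * fromℤ j                            ∎
    where
    s = ℤ.sign i
    t = ℤ.sign j
    a = ℤ.∣ i ∣
    b = ℤ.∣ j ∣
    interchange : ∀ w x y z → (w * x) * (y * z) ≈ (w * y) * (x * z)
    interchange w x y z = begin
      (w * x) * (y * z) ≈⟨ *-assoc w x _ ⟩
      w * (x * (y * z)) ≈⟨ *-congˡ (trans (sym (*-assoc x y z))
                                  (trans (*-congʳ (*-comm x y)) (*-assoc y x z))) ⟩
      w * (y * (x * z)) ≈⟨ *-assoc w y _ ⟨
      (w * y) * (x * z) ∎

  fromℤ-neg : ∀ i → fromℤ (ℤ.- i) ≈ - fromℤ i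
  fromℤ-neg (+ zero)  = sym -0#≈0#
  fromℤ-neg (+ suc n) = refl
  fromℤ-neg -[1+ n ]  = sym (-‿involutive _)

  ℤ-morphism : ℤ.+-*-rawRing -Raw-AlmostCommutative⟶ fromCommutativeRing R
  ℤ-morphism = record
    { ⟦_⟧ = fromℤ ; +-homo = fromℤ-+ ; *-homo = fromℤ-* ; -‿homo = fromℤ-neg
    ; 0-homo = refl ; 1-homo = refl }

  ℤ-equal? : ∀ i j → Maybe (fromℤ i ≈ fromℤ j)
  ℤ-equal? i j with i ℤ.≟ j
  ... | yes ≡.refl = just refl
  ... | no _       = nothing

  open import Algebra.Solver.Ring ℤ.+-*-rawRing (fromCommutativeRing R) ℤ-morphism ℤ-equal? public

  ‵0 ‵1 : ∀ {n} → Polynomial n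
  ‵0 = con (+ 0)
  ‵1 = con (+ 1)

module CycleSecondDifference {c ℓ} (R : CommutativeRing c ℓ) where

  open CommutativeRing R hiding (zero)
  open MatrixDefs R
  open IntegerCoefficients R using (solve; _:=_; _:+_; _:*_; :-_; ‵0; ‵1)
  open import Algebra.Properties.Ring ring
    using (-0#≈0#; -‿distribˡ-*; -‿distribʳ-*; -‿involutive)
  open import Algebra.Properties.AbelianGroup +-abelianGroup using (inverseʳ-unique)
  open import Algebra.Properties.Semiring.Sum semiring
    using (sum; ∑-distrib-+; *-distribˡ-sum; sum-remove)
  open import Algebra.Properties.Semiring.Mult semiring
    using (×1-homo-*) renaming (_×_ to _×ᵤ_)
  open import Data.Fin using (Fin; zero; suc; toℕ; fromℕ<; inject≤; punchIn; punchOut)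
  import Data.Fin.Properties as Fin
  open import Data.Bool using (true; false; if_then_else_; T; _∨_; _∧_)
  open import Data.Bool.Properties using (∨-identityʳ; ∧-zeroʳ; ∧-identityʳ)
  open import Relation.Nullary.Decidable using (isYes≗does)
  open import Relation.Binary.Reasoning.Setoid setoid

  -- Finite sums and the Kronecker delta

  ∑≡sum : ∀ {n} (f : Fin n → Carrier) → ∑ f ≡ sum f
  ∑≡sum {zero}  f = ≡.refl
  ∑≡sum {suc n} f = ≡.cong (f zero +_) (∑≡sum (λ i → f (suc i)))

  ∑-cong : ∀ {n} {f g : Fin n → Carrier} → (∀ i → f i ≈ g i) → ∑ f ≈ ∑ g
  ∑-cong {zero}  f≈g = refl
  ∑-cong {suc n} f≈g = +-cong (f≈g zero) (∑-cong (λ i → f≈g (suc i)))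

  ∑-zero : ∀ {n} {f : Fin n → Carrier} → (∀ i → f i ≈ 0#) → ∑ f ≈ 0#
  ∑-zero {zero}  f≈0 = refl
  ∑-zero {suc n} f≈0 = trans (+-cong (f≈0 zero) (∑-zero (λ i → f≈0 (suc i)))) (+-identityʳ 0#)

  ∑-+ : ∀ {n} (f g : Fin n → Carrier) → ∑ (λ i → f i + g i) ≈ ∑ f + ∑ g
  ∑-+ f g = begin
    ∑ (λ i → f i + g i)   ≡⟨ ∑≡sum (λ i → f i + g i) ⟩
    sum (λ i → f i + g i) ≈⟨ ∑-distrib-+ f g ⟩
    sum f + sum g         ≡⟨ ≡.cong₂ _+_ (∑≡sum f) (∑≡sum g) ⟨
    ∑ f + ∑ g             ∎

  ∑-*ˡ : ∀ {n} x (f : Fin n → Carrier) → ∑ (λ i → x * f i) ≈ x * ∑ f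
  ∑-*ˡ x f = begin
    ∑ (λ i → x * f i)   ≡⟨ ∑≡sum (λ i → x * f i) ⟩
    sum (λ i → x * f i) ≈⟨ *-distribˡ-sum x f ⟨
    x * sum f           ≡⟨ ≡.cong (x *_) (∑≡sum f) ⟨
    x * ∑ f             ∎

  ∑-punchIn : ∀ {n} (j : Fin (suc n)) (f : Fin (suc n) → Carrier) →
              ∑ f ≈ f j + ∑ (λ i → f (punchIn j i))
  ∑-punchIn j f = begin
    ∑ f                               ≡⟨ ∑≡sum f ⟩
    sum f                             ≈⟨ sum-remove f ⟩
    f j + sum (λ i → f (punchIn j i)) ≡⟨ ≡.cong (f j +_) (∑≡sum (λ i → f (punchIn j i))) ⟨
    f j + ∑ (λ i → f (punchIn j i))   ∎

  ≡ᵇ-refl : ∀ a → (a ≡ᵇ a) ≡ true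
  ≡ᵇ-refl zero    = ≡.refl
  ≡ᵇ-refl (suc a) = ≡ᵇ-refl a

  ≡ᵇ-sym : ∀ a b → (a ≡ᵇ b) ≡ (b ≡ᵇ a)
  ≡ᵇ-sym zero    zero    = ≡.refl
  ≡ᵇ-sym zero    (suc b) = ≡.refl
  ≡ᵇ-sym (suc a) zero    = ≡.refl
  ≡ᵇ-sym (suc a) (suc b) = ≡ᵇ-sym a b

  ≢⇒≡ᵇ-false : ∀ {a b} → a ≢ b → (a ≡ᵇ b) ≡ false
  ≢⇒≡ᵇ-false {a} {b} a≢b with a ≡ᵇ b in eq
  ... | true  = ⊥-elim (a≢b (ℕ.≡ᵇ⇒≡ a b (≡.subst T (≡.sym eq) _)))
  ... | false = ≡.refl

  -- Unlike Id, whose test ⌊ _ ≟ _ ⌋ is stuck on variables, δ computes on suc/suc.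
  δ : ℕ → ℕ → Carrier
  δ a b = if a ≡ᵇ b then 1# else 0#

  Id≡δ : ∀ {n} (i j : Fin n) → Id i j ≡ δ (toℕ i) (toℕ j)
  Id≡δ i j = ≡.cong (if_then 1# else 0#) (isYes≗does (toℕ i ℕ.≟ toℕ j))

  δ-refl : ∀ a → δ a a ≡ 1#
  δ-refl a = ≡.cong (if_then 1# else 0#) (≡ᵇ-refl a)

  δ-sym : ∀ a b → δ a b ≡ δ b a
  δ-sym a b = ≡.cong (if_then 1# else 0#) (≡ᵇ-sym a b)

  δ-≢ : ∀ {a b} → a ≢ b → δ a b ≡ 0#
  δ-≢ a≢b = ≡.cong (if_then 1# else 0#) (≢⇒≡ᵇ-false a≢b)

  Id-sym : ∀ {n} (i j : Fin n) → Id i j ≈ Id j i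
  Id-sym i j = reflexive (≡.trans (Id≡δ i j) (≡.trans (δ-sym (toℕ i) (toℕ j)) (≡.sym (Id≡δ j i))))

  ∑-δ : ∀ {n} j (j<n : j < n) (f : Fin n → Carrier) →
        ∑ (λ s → δ j (toℕ s) * f s) ≈ f (fromℕ< j<n)
  ∑-δ {suc n} zero    _         f =
    trans (+-cong (*-identityˡ _) (∑-zero (λ s → zeroˡ (f (suc s))))) (+-identityʳ _)
  ∑-δ {suc n} (suc j) (s≤s j<n) f =
    trans (+-cong (zeroˡ _) (∑-δ j j<n (λ s → f (suc s)))) (+-identityˡ _)

  ∑-Idˡ : ∀ {n} (i : Fin n) (f : Fin n → Carrier) → ∑ (λ s → Id i s * f s) ≈ f i
  ∑-Idˡ i f = begin
    ∑ (λ s → Id i s * f s)            ≈⟨ ∑-cong (λ s → *-congʳ (reflexive (Id≡δ i s))) ⟩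
    ∑ (λ s → δ (toℕ i) (toℕ s) * f s) ≈⟨ ∑-δ (toℕ i) (Fin.toℕ<n i) f ⟩
    f (fromℕ< (Fin.toℕ<n i))          ≡⟨ ≡.cong f (Fin.fromℕ<-toℕ i _) ⟩
    f i                               ∎

  ∑-Idʳ : ∀ {n} (j : Fin n) (f : Fin n → Carrier) → ∑ (λ s → f s * Id s j) ≈ f j
  ∑-Idʳ j f = trans (∑-cong (λ s → trans (*-comm _ _) (*-congʳ (Id-sym s j)))) (∑-Idˡ j f)

  fromℕ≡× : ∀ n → fromℕ n ≡ n ×ᵤ 1#
  fromℕ≡× zero    = ≡.refl
  fromℕ≡× (suc n) = ≡.cong (1# +_) (fromℕ≡× n)

  fromℕ-* : ∀ m n → fromℕ (m ℕ.* n) ≈ fromℕ m * fromℕ n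
  fromℕ-* m n rewrite fromℕ≡× (m ℕ.* n) | fromℕ≡× m | fromℕ≡× n = ×1-homo-* m n

  fromℕ-*-zeroʳ : ∀ a b → fromℕ b ≈ 0# → fromℕ (a ℕ.* b) ≈ 0#
  fromℕ-*-zeroʳ a b b≈0 = trans (fromℕ-* a b) (trans (*-congˡ b≈0) (zeroʳ _))

  fromℕ-1+*-zeroʳ : ∀ a b → fromℕ b ≈ 0# → fromℕ (1 ℕ.+ a ℕ.* b) ≈ 1#
  fromℕ-1+*-zeroʳ a b b≈0 = trans (+-congˡ (fromℕ-*-zeroʳ a b b≈0)) (+-identityʳ 1#)

  ∣⇒fromℕ≈0 : ∀ {p n} → p ∣ n → fromℕ p ≈ 0# → fromℕ n ≈ 0#
  ∣⇒fromℕ≈0 {p} (divides q ≡.refl) p≈0 = fromℕ-*-zeroʳ q p p≈0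

  -- The second-difference operator of the cycle

  next : ℕ → ℕ → ℕ
  next n k = if suc k ≡ᵇ n then 0 else suc k

  prev : ℕ → ℕ → ℕ
  prev n zero    = ℕ.pred n
  prev n (suc k) = k

  next<n : ∀ {n k} → k < n → next n k < n
  next<n {n} {k} k<n with suc k ≡ᵇ n in eq
  ... | true  = ℕ.≤-<-trans z≤n k<n
  ... | false = ℕ.≤∧≢⇒< k<n (λ k+1≡n → ≡.subst T eq (ℕ.≡⇒≡ᵇ (suc k) n k+1≡n))

  prev<n : ∀ {n k} → k < n → prev n k < n
  prev<n {suc n} {zero}  _   = ℕ.n<1+n n
  prev<n {n}     {suc k} k<n = ℕ.<-trans (ℕ.n<1+n k) k<n

  next-inner : ∀ {n k} → suc k < n → next n k ≡ suc k
  next-inner {n} {k} k+1<n rewrite ≢⇒≡ᵇ-false {suc k} {n} (ℕ.<⇒≢ k+1<n) = ≡.refl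

  next-≢ : ∀ {n k} → 1 < n → next n k ≢ k
  next-≢ {n} {k} 1<n with suc k ≡ᵇ n in eq
  ... | true  = λ 0≡k → ℕ.<⇒≢ 1<n (≡.trans (≡.cong suc 0≡k)
                                    (ℕ.≡ᵇ⇒≡ (suc k) n (≡.subst T (≡.sym eq) _)))
  ... | false = ℕ.1+n≢n

  fromℕ-next : ∀ n → fromℕ n ≈ 0# → ∀ k → fromℕ (next n k) ≈ 1# + fromℕ k
  fromℕ-next n n≈0 k with suc k ≡ᵇ n in eq
  ... | true  = sym (trans (reflexive (≡.cong fromℕ (ℕ.≡ᵇ⇒≡ (suc k) n (≡.subst T (≡.sym eq) _))))
                           n≈0)
  ... | false = refl

  fromℕ-prev : ∀ n → fromℕ n ≈ 0# → ∀ {k} → k < n → 1# + fromℕ (prev n k) ≈ fromℕ k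
  fromℕ-prev (suc n) n≈0 {zero}  _ = n≈0
  fromℕ-prev n       n≈0 {suc k} _ = refl

  cyclicP≡δ-next : ∀ n (t s : Fin n) → cyclicP n t s ≡ δ (next n (toℕ t)) (toℕ s)
  cyclicP≡δ-next n t s
    rewrite isYes≗does (suc (toℕ t) ℕ.≟ toℕ s) | isYes≗does (suc (toℕ t) ℕ.≟ n)
          | isYes≗does (toℕ s ℕ.≟ 0)
    with suc (toℕ t) ≡ᵇ n in eq
  ... | true  = ≡.cong (if_then 1# else 0#)
      (≡.trans (≡.cong (_∨ (toℕ s ≡ᵇ 0)) (≢⇒≡ᵇ-false t+1≢s)) (≡ᵇ-sym (toℕ s) 0))
    where
    t+1≢s : suc (toℕ t) ≢ toℕ s
    t+1≢s t+1≡s = ℕ.<⇒≢ (Fin.toℕ<n s)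
                        (≡.trans (≡.sym t+1≡s) (ℕ.≡ᵇ⇒≡ _ n (≡.subst T (≡.sym eq) _)))
  ... | false = ≡.cong (if_then 1# else 0#) (∨-identityʳ _)

  cyclicPᵀ≡δ-prev : ∀ n (t s : Fin n) → cyclicP n s t ≡ δ (prev n (toℕ t)) (toℕ s)
  cyclicPᵀ≡δ-prev n t s
    rewrite isYes≗does (suc (toℕ s) ℕ.≟ toℕ t) | isYes≗does (suc (toℕ s) ℕ.≟ n)
          | isYes≗does (toℕ t ℕ.≟ 0)
    = ≡.cong (if_then 1# else 0#) (wrap (toℕ t) (toℕ s) (Fin.toℕ<n s))
    where
    wrap : ∀ a b → b < n → (suc b ≡ᵇ a) ∨ ((suc b ≡ᵇ n) ∧ (a ≡ᵇ 0)) ≡ (prev n a ≡ᵇ b)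
    wrap zero    b (s≤s _) = ≡.trans (∧-identityʳ _) (≡ᵇ-sym b (ℕ.pred n))
    wrap (suc a) b _ rewrite ∧-zeroʳ (suc b ≡ᵇ n) | ∨-identityʳ (b ≡ᵇ a) = ≡ᵇ-sym b a

  M₁≡δ : ∀ n (i j : Fin n) →
         M₁ n i j ≡ (δ (prev n (toℕ i)) (toℕ j) + - (1# + 1#) * δ (toℕ i) (toℕ j))
                    + δ (next n (toℕ i)) (toℕ j)
  M₁≡δ n i j = ≡.cong₂ _+_ (≡.cong₂ (λ x y → x + - (1# + 1#) * y)
                                    (cyclicPᵀ≡δ-prev n i j) (Id≡δ i j))
                           (cyclicP≡δ-next n i j)

  M₁-sym : ∀ n (i j : Fin n) → M₁ n i j ≈ M₁ n j i
  M₁-sym n i j = trans (+-congʳ (+-congˡ (*-congˡ (Id-sym i j)))) (swap _ _ _)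
    where
    swap : ∀ x y z → (x + - (1# + 1#) * y) + z ≈ (z + - (1# + 1#) * y) + x
    swap = solve 3 (λ x y z → (x :+ :- (‵1 :+ ‵1) :* y) :+ z := (z :+ :- (‵1 :+ ‵1) :* y) :+ x) refl

  Δ² : ℕ → (ℕ → Carrier) → ℕ → Carrier
  Δ² n F k = (F (prev n k) + - (1# + 1#) * F k) + F (next n k)

  M₁-action : ∀ n (t : Fin n) (F : ℕ → Carrier) →
              ∑ (λ s → M₁ n t s * F (toℕ s)) ≈ Δ² n F (toℕ t)
  M₁-action n t F = begin
    ∑ (λ s → M₁ n t s * F (toℕ s))
      ≈⟨ ∑-cong (λ s → trans (*-congʳ (reflexive (M₁≡δ n t s))) (expand _ _ _ _)) ⟩
    ∑ (λ s → (at p s + - (1# + 1#) * at k s) + at q s)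
      ≈⟨ ∑-+ (λ s → at p s + - (1# + 1#) * at k s) (at q) ⟩
    ∑ (λ s → at p s + - (1# + 1#) * at k s) + ∑ (at q)
      ≈⟨ +-congʳ (trans (∑-+ (at p) (λ s → - (1# + 1#) * at k s)) (+-congˡ (∑-*ˡ _ (at k)))) ⟩
    (∑ (at p) + - (1# + 1#) * ∑ (at k)) + ∑ (at q)
      ≈⟨ +-cong (+-cong (∑-at (prev<n t<n)) (*-congˡ (∑-at t<n))) (∑-at (next<n t<n)) ⟩
    Δ² n F k ∎
    where
    k = toℕ t
    p = prev n k
    q = next n k
    t<n = Fin.toℕ<n t
    at : ℕ → Fin n → Carrier
    at j s = δ j (toℕ s) * F (toℕ s)
    ∑-at : ∀ {j} → j < n → ∑ (at j) ≈ F j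
    ∑-at j<n = trans (∑-δ _ j<n (λ s → F (toℕ s))) (reflexive (≡.cong F (Fin.toℕ-fromℕ< j<n)))
    expand : ∀ x y z w → ((x + - (1# + 1#) * y) + z) * w
                         ≈ (x * w + - (1# + 1#) * (y * w)) + z * w
    expand = solve 4 (λ x y z w → ((x :+ :- (‵1 :+ ‵1) :* y) :+ z) :* w
                                := (x :* w :+ :- (‵1 :+ ‵1) :* (y :* w)) :+ z :* w) refl

  InKernel : ∀ {m n} → Matrix m n → (Fin n → Carrier) → Set ℓ
  InKernel A v = ∀ i → ∑ (λ s → A i s * v s) ≈ 0#

  Δ²≈0⇒M₁-kernel : ∀ n (F : ℕ → Carrier) → (∀ {k} → k < n → Δ² n F k ≈ 0#) →
                   InKernel (M₁ n) (λ s → F (toℕ s))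
  Δ²≈0⇒M₁-kernel n F Δ²F≈0 t = trans (M₁-action n t F) (Δ²F≈0 (Fin.toℕ<n t))

  M₁-kernel⇒Δ²≈0 : ∀ n (F : ℕ → Carrier) → InKernel (M₁ n) (λ s → F (toℕ s)) →
                   ∀ {k} → k < n → Δ² n F k ≈ 0#
  M₁-kernel⇒Δ²≈0 n F F∈ker {k} k<n = begin
    Δ² n F k                                  ≡⟨ ≡.cong (Δ² n F) (Fin.toℕ-fromℕ< k<n) ⟨
    Δ² n F (toℕ (fromℕ< k<n))                 ≈⟨ M₁-action n (fromℕ< k<n) F ⟨
    ∑ (λ s → M₁ n (fromℕ< k<n) s * F (toℕ s)) ≈⟨ F∈ker (fromℕ< k<n) ⟩
    0#                                        ∎

  Δ²-const : ∀ n α k → Δ² n (λ _ → α) k ≈ 0#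
  Δ²-const n α k = solve 1 (λ α → (α :+ :- (‵1 :+ ‵1) :* α) :+ α := ‵0) refl α

  Δ²-affine : ∀ n → fromℕ n ≈ 0# → ∀ α β {k} → k < n →
              Δ² n (λ j → α + β * fromℕ j) k ≈ 0#
  Δ²-affine n n≈0 α β {k} k<n = begin
    Δ² n (λ j → α + β * fromℕ j) k
      ≈⟨ +-cong (+-congˡ (*-congˡ (+-congˡ (*-congˡ k≈1+x)))) (+-congˡ (*-congˡ next≈2+x)) ⟩
    ((α + β * x) + - (1# + 1#) * (α + β * (1# + x))) + (α + β * (1# + (1# + x)))
      ≈⟨ collapse α β x ⟩
    0# ∎
    where
    x = fromℕ (prev n k)
    k≈1+x : fromℕ k ≈ 1# + x
    k≈1+x = sym (fromℕ-prev n n≈0 k<n)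
    next≈2+x : fromℕ (next n k) ≈ 1# + (1# + x)
    next≈2+x = trans (fromℕ-next n n≈0 k) (+-congˡ k≈1+x)
    collapse : ∀ α β x → ((α + β * x) + - (1# + 1#) * (α + β * (1# + x)))
                         + (α + β * (1# + (1# + x))) ≈ 0#
    collapse = solve 3 (λ α β x → ((α :+ β :* x) :+ :- (‵1 :+ ‵1) :* (α :+ β :* (‵1 :+ x)))
                                  :+ (α :+ β :* (‵1 :+ (‵1 :+ x))) := ‵0) refl

  -- Congruence to the leading principal block

  Id⊕-⊗-Id⊕ : ∀ {n} (Y Z : Matrix n n) → (∀ i t j → Y i t * Z t j ≈ 0#) →
              ∀ i j → ((Id ⊕ Y) ⊗ (Id ⊕ Z)) i j ≈ (Id i j + Z i j) + Y i j
  Id⊕-⊗-Id⊕ Y Z YZ≈0 i j = begin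
    ∑ (λ t → (Id i t + Y i t) * (Id t j + Z t j))
      ≈⟨ ∑-cong (λ t → trans (distribʳ (Id t j + Z t j) (Id i t) (Y i t))
                             (+-congˡ (distribˡ (Y i t) (Id t j) (Z t j)))) ⟩
    ∑ (λ t → Id i t * (Id t j + Z t j) + (Y i t * Id t j + Y i t * Z t j))
      ≈⟨ trans (∑-+ (λ t → Id i t * (Id t j + Z t j)) (λ t → Y i t * Id t j + Y i t * Z t j))
               (+-congˡ (∑-+ (λ t → Y i t * Id t j) (λ t → Y i t * Z t j))) ⟩
    ∑ (λ t → Id i t * (Id t j + Z t j)) + (∑ (λ t → Y i t * Id t j) + ∑ (λ t → Y i t * Z t j))
      ≈⟨ +-cong (∑-Idˡ i (λ t → Id t j + Z t j))
                (+-cong (∑-Idʳ j (Y i)) (∑-zero (λ t → YZ≈0 i t j))) ⟩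
    (Id i j + Z i j) + (Y i j + 0#)
      ≈⟨ +-congˡ (+-identityʳ _) ⟩
    (Id i j + Z i j) + Y i j ∎

  Id⊕-invertible : ∀ {n} (Y : Matrix n n) → (∀ i t j → Y i t * Y t j ≈ 0#) → Invertible (Id ⊕ Y)
  Id⊕-invertible Y Y²≈0 = (Id ⊕ -Y)
    , (λ i j → trans (Id⊕-⊗-Id⊕ Y -Y (λ i t j → *-neg (Y²≈0 i t j)) i j) (cancelʳ _ _))
    , (λ i j → trans (Id⊕-⊗-Id⊕ -Y Y (λ i t j → neg-* (Y²≈0 i t j)) i j) (cancelˡ _ _))
    where
    -Y : Matrix _ _
    -Y i j = - Y i j
    *-neg : ∀ {a b} → a * b ≈ 0# → a * - b ≈ 0#
    *-neg {a} {b} ab≈0 = trans (sym (-‿distribʳ-* a b)) (trans (-‿cong ab≈0) -0#≈0#)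
    neg-* : ∀ {a b} → a * b ≈ 0# → - a * b ≈ 0#
    neg-* {a} {b} ab≈0 = trans (sym (-‿distribˡ-* a b)) (trans (-‿cong ab≈0) -0#≈0#)
    cancelʳ : ∀ x y → (x + - y) + y ≈ x
    cancelʳ = solve 2 (λ x y → (x :+ :- y) :+ y := x) refl
    cancelˡ : ∀ x y → (x + y) + - y ≈ x
    cancelˡ = solve 2 (λ x y → (x :+ y) :+ :- y := x) refl

  pad-inner : ∀ {k m} (V : Matrix k k) (i j : Fin m) (i<k : toℕ i < k) (j<k : toℕ j < k) →
              pad m V i j ≡ V (fromℕ< i<k) (fromℕ< j<k)
  pad-inner {k} V i j i<k j<k with toℕ i <? k | toℕ j <? k
  ... | yes _  | yes _  = ≡.refl
  ... | yes _  | no j≮k = ⊥-elim (j≮k j<k)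
  ... | no i≮k | _      = ⊥-elim (i≮k i<k)

  pad-right : ∀ {k m} (V : Matrix k k) (i j : Fin m) → k ≤ toℕ j → pad m V i j ≡ 0#
  pad-right {k} V i j k≤j with toℕ i <? k | toℕ j <? k
  ... | yes _ | yes j<k = ⊥-elim (ℕ.<⇒≱ j<k k≤j)
  ... | yes _ | no _    = ≡.refl
  ... | no _  | _       = ≡.refl

  pad-lower : ∀ {k m} (V : Matrix k k) (i j : Fin m) → k ≤ toℕ i → pad m V i j ≡ 0#
  pad-lower {k} V i j k≤i with toℕ i <? k | toℕ j <? k
  ... | yes i<k | _ = ⊥-elim (ℕ.<⇒≱ i<k k≤i)
  ... | no _    | _ = ≡.refl

  -- B keeps the unit vectors e j for j < r and replaces e j for j ≥ r by the kernel vector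
  -- κ j; then U B vanishes beyond column r, and B = Id + X with X² = 0.
  module Congruence {n r} (r≤n : r ≤ n) (U : Matrix n n) (U-sym : ∀ i j → U i j ≈ U j i)
    (κ : Fin n → Fin n → Carrier)
    (κ-tail : ∀ j s → r ≤ toℕ j → r ≤ toℕ s → κ j s ≈ Id s j)
    (κ-ker : ∀ j → r ≤ toℕ j → InKernel U (κ j)) where

    X : Matrix n n
    X i t with toℕ i <? r | toℕ t <? r
    ... | yes _ | no _ = κ t i
    ... | _     | _    = 0#

    X-lower : ∀ i t → r ≤ toℕ i → X i t ≈ 0#
    X-lower i t r≤i with toℕ i <? r | toℕ t <? r
    ... | yes i<r | _     = ⊥-elim (ℕ.<⇒≱ i<r r≤i)
    ... | no _    | yes _ = refl
    ... | no _    | no _  = refl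

    X-left : ∀ i t → toℕ t < r → X i t ≈ 0#
    X-left i t t<r with toℕ i <? r | toℕ t <? r
    ... | yes _ | yes _  = refl
    ... | yes _ | no t≮r = ⊥-elim (t≮r t<r)
    ... | no _  | _      = refl

    X²≈0 : ∀ i t j → X i t * X t j ≈ 0#
    X²≈0 i t j = split (toℕ t <? r)
      where
      split : Dec (toℕ t < r) → X i t * X t j ≈ 0#
      split (yes t<r) = trans (*-congʳ (X-left i t t<r)) (zeroˡ _)
      split (no t≮r)  = trans (*-congˡ (X-lower t j (ℕ.≮⇒≥ t≮r))) (zeroʳ _)

    B : Matrix n n
    B = Id ⊕ X

    B-right : ∀ s j → r ≤ toℕ j → B s j ≈ κ j s
    B-right s j r≤j with toℕ s <? r | toℕ j <? r
    ... | _       | yes j<r = ⊥-elim (ℕ.<⇒≱ j<r r≤j)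
    ... | yes s<r | no _    = trans (+-congʳ (reflexive (≡.trans (Id≡δ s j) (δ-≢ s≢j))))
                                    (+-identityˡ _)
      where
      s≢j : toℕ s ≢ toℕ j
      s≢j s≡j = ℕ.<⇒≱ s<r (≡.subst (r ≤_) (≡.sym s≡j) r≤j)
    ... | no s≮r  | no _    = trans (+-identityʳ _) (sym (κ-tail j s r≤j (ℕ.≮⇒≥ s≮r)))

    B-left : ∀ s j → toℕ j < r → B s j ≈ Id s j
    B-left s j j<r = trans (+-congˡ (X-left s j j<r)) (+-identityʳ _)

    UB-right : ∀ t j → r ≤ toℕ j → (U ⊗ B) t j ≈ 0#
    UB-right t j r≤j = trans (∑-cong (λ s → *-congˡ (B-right s j r≤j))) (κ-ker j r≤j t)

    UB-left : ∀ t j → toℕ j < r → (U ⊗ B) t j ≈ U t j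
    UB-left t j j<r = trans (∑-cong (λ s → *-congˡ (B-left s j j<r))) (∑-Idʳ j (U t))

    BᵀUB-right : ∀ i j → r ≤ toℕ j → ((B ᵀ) ⊗ (U ⊗ B)) i j ≈ 0#
    BᵀUB-right i j r≤j = ∑-zero (λ t → trans (*-congˡ (UB-right t j r≤j)) (zeroʳ _))

    BᵀUB-lower : ∀ i j → r ≤ toℕ i → toℕ j < r → ((B ᵀ) ⊗ (U ⊗ B)) i j ≈ 0#
    BᵀUB-lower i j r≤i j<r = begin
      ∑ (λ t → B t i * (U ⊗ B) t j) ≈⟨ ∑-cong (λ t → trans (*-congˡ (UB-left t j j<r))
                                              (trans (*-comm _ _) (*-congʳ (U-sym t j)))) ⟩
      ∑ (λ t → U j t * B t i)       ≈⟨ UB-right j i r≤i ⟩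
      0#                            ∎

    BᵀUB-inner : ∀ i j → toℕ i < r → toℕ j < r → ((B ᵀ) ⊗ (U ⊗ B)) i j ≈ U i j
    BᵀUB-inner i j i<r j<r = begin
      ∑ (λ t → B t i * (U ⊗ B) t j) ≈⟨ ∑-cong (λ t → *-cong (trans (B-left t i i<r) (Id-sym t i))
                                                          (UB-left t j j<r)) ⟩
      ∑ (λ t → Id i t * U t j)      ≈⟨ ∑-Idˡ i (λ t → U t j) ⟩
      U i j                         ∎

    inject≤-fromℕ< : ∀ a (a<r : toℕ a < r) → inject≤ (fromℕ< a<r) r≤n ≡ a
    inject≤-fromℕ< a a<r =
      Fin.toℕ-injective (≡.trans (Fin.toℕ-inject≤ _ r≤n) (Fin.toℕ-fromℕ< a<r))

    BᵀUB≈pad : ((B ᵀ) ⊗ (U ⊗ B)) ≈ᴹ pad n (principal r≤n U)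
    BᵀUB≈pad i j = blocks (toℕ i <? r) (toℕ j <? r)
      where
      V = principal r≤n U
      blocks : Dec (toℕ i < r) → Dec (toℕ j < r) → ((B ᵀ) ⊗ (U ⊗ B)) i j ≈ pad n V i j
      blocks _         (no j≮r)  = trans (BᵀUB-right i j (ℕ.≮⇒≥ j≮r))
                                         (sym (reflexive (pad-right V i j (ℕ.≮⇒≥ j≮r))))
      blocks (no i≮r)  (yes j<r) = trans (BᵀUB-lower i j (ℕ.≮⇒≥ i≮r) j<r)
                                         (sym (reflexive (pad-lower V i j (ℕ.≮⇒≥ i≮r))))
      blocks (yes i<r) (yes j<r) = trans (BᵀUB-inner i j i<r j<r) (sym (reflexive
        (≡.trans (pad-inner V i j i<r j<r) (≡.cong₂ U (inject≤-fromℕ< i i<r) (inject≤-fromℕ< j j<r)))))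

    equivalent-principal : Equivalent U (principal r≤n U)
    equivalent-principal = r≤n , B , Id⊕-invertible X X²≈0 , BᵀUB≈pad

  -- Determinants of second-difference matrices of paths

  minor : ∀ {n} → Matrix (suc n) (suc n) → Fin (suc n) → Matrix n n
  minor A j i k = A (suc i) (punchIn j k)

  -- det A is definitionally ∑ (laplaceTerm A).
  laplaceTerm : ∀ {n} → Matrix (suc n) (suc n) → Fin (suc n) → Carrier
  laplaceTerm A j = ((- 1#) ^ᶠ toℕ j) * (A zero j * det (minor A j))

  det-cong : ∀ {n} {A B : Matrix n n} → A ≈ᴹ B → det A ≈ det B
  det-cong {zero}  A≈B = refl
  det-cong {suc n} {A} {B} A≈B = ∑-cong {f = laplaceTerm A} {g = laplaceTerm B}
    (λ j → *-congˡ (*-cong (A≈B zero j) (det-cong (λ i k → A≈B (suc i) (punchIn j k)))))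

  det-zero-column : ∀ {n} (A : Matrix (suc n) (suc n)) → (∀ i → A i zero ≈ 0#) → det A ≈ 0#
  det-zero-column {zero}  A A₀≈0 =
    trans (+-identityʳ _) (trans (*-congˡ (trans (*-congʳ (A₀≈0 zero)) (zeroˡ _))) (zeroʳ _))
  det-zero-column {suc n} A A₀≈0 =
    ∑-zero {f = laplaceTerm A} (λ j → trans (*-congˡ (term≈0 j)) (zeroʳ _))
    where
    term≈0 : ∀ j → A zero j * det (minor A j) ≈ 0#
    term≈0 zero    = trans (*-congʳ (A₀≈0 zero)) (zeroˡ _)
    term≈0 (suc j) =
      trans (*-congˡ (det-zero-column (minor A (suc j)) (λ i → A₀≈0 (suc i)))) (zeroʳ _)

  -- The clause for suc/suc comes first so that it holds definitionally.
  tri : ℕ → ℕ → Carrier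
  tri (suc a)       (suc b)       = tri a b
  tri zero          zero          = - (1# + 1#)
  tri zero          (suc zero)    = 1#
  tri zero          (suc (suc _)) = 0#
  tri (suc zero)    zero          = 1#
  tri (suc (suc _)) zero          = 0#

  Tridiagonal : ∀ r → Matrix r r
  Tridiagonal r i j = tri (toℕ i) (toℕ j)

  det-minor₀₁ : ∀ r → det (minor (Tridiagonal (suc (suc r))) (suc zero)) ≈ det (Tridiagonal r)
  det-minor₀₁ zero    = trans (+-identityʳ _) (trans (*-identityˡ _) (*-identityˡ _))
  det-minor₀₁ (suc r) = begin
    det (minor (Tridiagonal (3 ℕ.+ r)) (suc zero))
      ≈⟨ +-cong (trans (*-identityˡ _) (*-identityˡ _))
                (+-cong (trans (*-congˡ (trans (*-congˡ zero-column) (zeroʳ _))) (zeroʳ _))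
                        (∑-zero {r} (λ j → trans (*-congˡ (zeroˡ _)) (zeroʳ _)))) ⟩
    det (Tridiagonal (suc r)) + (0# + 0#)
      ≈⟨ trans (+-congˡ (+-identityʳ 0#)) (+-identityʳ _) ⟩
    det (Tridiagonal (suc r)) ∎
    where
    zero-column : det (minor (minor (Tridiagonal (3 ℕ.+ r)) (suc zero)) (suc zero)) ≈ 0#
    zero-column = det-zero-column (minor (minor (Tridiagonal (3 ℕ.+ r)) (suc zero)) (suc zero))
                                  (λ _ → refl)

  det-Tridiagonal-step : ∀ r → det (Tridiagonal (suc (suc r)))
                               ≈ - (1# + 1#) * det (Tridiagonal (suc r)) + - det (Tridiagonal r)
  det-Tridiagonal-step r = begin
    det (Tridiagonal (suc (suc r)))
      ≈⟨ +-cong (*-identityˡ _) (+-cong (*-congˡ (*-congˡ (det-minor₀₁ r)))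
                                         (∑-zero {r} (λ j → trans (*-congˡ (zeroˡ _)) (zeroʳ _)))) ⟩
    - (1# + 1#) * det (Tridiagonal (suc r)) + ((- 1# * 1#) * (1# * det (Tridiagonal r)) + 0#)
      ≈⟨ simplify _ _ ⟩
    - (1# + 1#) * det (Tridiagonal (suc r)) + - det (Tridiagonal r) ∎
    where
    simplify : ∀ a b → - (1# + 1#) * a + ((- 1# * 1#) * (1# * b) + 0#) ≈ - (1# + 1#) * a + - b
    simplify = solve 2 (λ a b → :- (‵1 :+ ‵1) :* a :+ ((:- ‵1 :* ‵1) :* (‵1 :* b) :+ ‵0)
                               := :- (‵1 :+ ‵1) :* a :+ :- b) refl

  det-Tridiagonal : ∀ r → det (Tridiagonal r) ≈ ((- 1#) ^ᶠ r) * fromℕ (suc r)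
  det-Tridiagonal zero          = sym (trans (*-identityˡ _) (+-identityʳ 1#))
  det-Tridiagonal (suc zero)    = solve 0 (‵1 :* (:- (‵1 :+ ‵1) :* ‵1) :+ ‵0
                                           := (:- ‵1 :* ‵1) :* (‵1 :+ (‵1 :+ ‵0))) refl
  det-Tridiagonal (suc (suc r)) = begin
    det (Tridiagonal (suc (suc r)))
      ≈⟨ det-Tridiagonal-step r ⟩
    - (1# + 1#) * det (Tridiagonal (suc r)) + - det (Tridiagonal r)
      ≈⟨ +-cong (*-congˡ (det-Tridiagonal (suc r))) (-‿cong (det-Tridiagonal r)) ⟩
    - (1# + 1#) * ((- 1# * e) * (1# + x)) + - (e * x)
      ≈⟨ recurrence e x ⟩
    (- 1# * (- 1# * e)) * (1# + (1# + x)) ∎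
    where
    e = (- 1#) ^ᶠ r
    x = fromℕ (suc r)
    recurrence : ∀ e x → - (1# + 1#) * ((- 1# * e) * (1# + x)) + - (e * x)
                         ≈ (- 1# * (- 1# * e)) * (1# + (1# + x))
    recurrence = solve 2 (λ e x → :- (‵1 :+ ‵1) :* ((:- ‵1 :* e) :* (‵1 :+ x)) :+ :- (e :* x)
                                 := (:- ‵1 :* (:- ‵1 :* e)) :* (‵1 :+ (‵1 :+ x))) refl

  neg-one-pow-square : ∀ e → ((- 1#) ^ᶠ e) * ((- 1#) ^ᶠ e) ≈ 1#
  neg-one-pow-square zero    = *-identityˡ 1#
  neg-one-pow-square (suc e) =
    trans (solve 1 (λ s → (:- ‵1 :* s) :* (:- ‵1 :* s) := s :* s) refl _) (neg-one-pow-square e)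

  nonsingular-by-det : ∀ {m} (V : Matrix m m) e {x} →
                       det V ≈ ((- 1#) ^ᶠ e) * x → ¬ x ≈ 0# → Nonsingular V
  nonsingular-by-det V e {x} det≈ x≉0 det≈0 = x≉0 (begin
    x           ≈⟨ *-identityˡ x ⟨
    1# * x      ≈⟨ *-congʳ (neg-one-pow-square e) ⟨
    (s * s) * x ≈⟨ *-assoc s s x ⟩
    s * (s * x) ≈⟨ *-congˡ (trans (sym det≈) det≈0) ⟩
    s * 0#      ≈⟨ zeroʳ s ⟩
    0#          ∎)
    where s = (- 1#) ^ᶠ e

  tri≈δ : ∀ a b → tri a b ≈ (δ (suc b) a + - (1# + 1#) * δ a b) + δ (suc a) b
  tri≈δ (suc a)       (suc b)       = tri≈δ a b
  tri≈δ zero          zero          = solve 0 (:- (‵1 :+ ‵1) := ‵0 :+ :- (‵1 :+ ‵1) :* ‵1 :+ ‵0) refl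
  tri≈δ zero          (suc zero)    = solve 0 (‵1 := ‵0 :+ :- (‵1 :+ ‵1) :* ‵0 :+ ‵1) refl
  tri≈δ zero          (suc (suc b)) = solve 0 (‵0 := ‵0 :+ :- (‵1 :+ ‵1) :* ‵0 :+ ‵0) refl
  tri≈δ (suc zero)    zero          = solve 0 (‵1 := ‵1 :+ :- (‵1 :+ ‵1) :* ‵0 :+ ‵0) refl
  tri≈δ (suc (suc a)) zero          = solve 0 (‵0 := ‵0 :+ :- (‵1 :+ ‵1) :* ‵0 :+ ‵0) refl

  δ-prev : ∀ {n} a {b} → suc b < n → δ (prev n a) b ≡ δ (suc b) a
  δ-prev {suc n} zero    b+1<n = δ-≢ (λ n≡b → ℕ.<⇒≢ b+1<n (≡.cong suc (≡.sym n≡b)))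
  δ-prev         (suc a) _     = δ-sym a _

  M₁≈tri : ∀ n (i j : Fin n) → suc (toℕ i) < n → suc (toℕ j) < n →
           M₁ n i j ≈ tri (toℕ i) (toℕ j)
  M₁≈tri n i j i+1<n j+1<n = begin
    M₁ n i j
      ≡⟨ M₁≡δ n i j ⟩
    (δ (prev n a) b + - (1# + 1#) * δ a b) + δ (next n a) b
      ≡⟨ ≡.cong₂ (λ x y → (x + - (1# + 1#) * δ a b) + δ y b) (δ-prev a j+1<n) (next-inner i+1<n) ⟩
    (δ (suc b) a + - (1# + 1#) * δ a b) + δ (suc a) b
      ≈⟨ tri≈δ a b ⟨
    tri a b ∎
    where
    a = toℕ i
    b = toℕ j

  principal-M₁ : ∀ {n r} (r≤n : r ≤ n) → r < n → principal r≤n (M₁ n) ≈ᴹ Tridiagonal r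
  principal-M₁ {n} r≤n r<n i j =
    trans (M₁≈tri n (inject≤ i r≤n) (inject≤ j r≤n) (bound i) (bound j))
          (reflexive (≡.cong₂ tri (Fin.toℕ-inject≤ i r≤n) (Fin.toℕ-inject≤ j r≤n)))
    where
    bound : ∀ a → suc (toℕ (inject≤ a r≤n)) < n
    bound a rewrite Fin.toℕ-inject≤ a r≤n = ℕ.<-≤-trans (s≤s (Fin.toℕ<n a)) r<n

  -- Rank

  avoid⇒punchIn : ∀ {k l} (σ : Fin k → Fin (suc l)) → InjectiveIdx σ → ∀ j → (∀ t → σ t ≢ j) →
                  Σ (Fin k → Fin l) λ σ′ → InjectiveIdx σ′ × (∀ t → punchIn j (σ′ t) ≡ σ t)
  avoid⇒punchIn σ σ-inj j miss =
      (λ t → punchOut (j≢σ t))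
    , (λ s t eq → σ-inj s t (Fin.punchOut-injective (j≢σ s) (j≢σ t) eq))
    , (λ t → Fin.punchIn-punchOut (j≢σ t))
    where
    j≢σ : ∀ t → j ≢ σ t
    j≢σ t j≡σt = miss t (≡.sym j≡σt)

  ∑-injection : ∀ {k n} (σ : Fin k → Fin n) → InjectiveIdx σ → (g : Fin n → Carrier) →
                (∀ j → (∀ t → σ t ≢ j) → g j ≈ 0#) → ∑ (λ t → g (σ t)) ≈ ∑ g
  ∑-injection {zero}          σ σ-inj g g-off = sym (∑-zero (λ j → g-off j (λ ())))
  ∑-injection {suc k} {zero}  σ σ-inj g g-off with σ zero
  ... | ()
  ∑-injection {suc k} {suc n} σ σ-inj g g-off = begin
    g j₀ + ∑ (λ t → g (σ (suc t)))
      ≈⟨ +-congˡ (∑-cong (λ t → reflexive (≡.cong g (≡.sym (σ′-eq t))))) ⟩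
    g j₀ + ∑ (λ t → g (punchIn j₀ (σ′ t)))
      ≈⟨ +-congˡ (∑-injection σ′ σ′-inj (λ j → g (punchIn j₀ j)) g′-off) ⟩
    g j₀ + ∑ (λ j → g (punchIn j₀ j))
      ≈⟨ ∑-punchIn j₀ g ⟨
    ∑ g ∎
    where
    j₀ = σ zero
    rest : Σ (Fin k → Fin n) λ σ′ → InjectiveIdx σ′ × (∀ t → punchIn j₀ (σ′ t) ≡ σ (suc t))
    rest = avoid⇒punchIn (λ t → σ (suc t)) (λ s t eq → Fin.suc-injective (σ-inj (suc s) (suc t) eq))
                         j₀ (λ t eq → Fin.0≢1+n (σ-inj zero (suc t) (≡.sym eq)))
    σ′ : Fin k → Fin n
    σ′ = proj₁ rest
    σ′-inj : InjectiveIdx σ′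
    σ′-inj = proj₁ (proj₂ rest)
    σ′-eq : ∀ t → punchIn j₀ (σ′ t) ≡ σ (suc t)
    σ′-eq = proj₂ (proj₂ rest)
    g′-off : ∀ j → (∀ t → σ′ t ≢ j) → g (punchIn j₀ j) ≈ 0#
    g′-off j miss = g-off (punchIn j₀ j) λ
      { zero    eq → Fin.punchInᵢ≢i j₀ j (≡.sym eq)
      ; (suc t) eq → miss t (Fin.punchIn-injective j₀ _ _ (≡.trans (σ′-eq t) eq)) }

  injection-surjective : ∀ {l} (σ : Fin l → Fin l) → InjectiveIdx σ → ∀ j → ∃ λ t → σ t ≡ j
  injection-surjective {suc l} σ σ-inj j with Fin.any? (λ t → σ t Fin.≟ j)
  ... | yes hit = hit
  ... | no ¬hit with avoid⇒punchIn σ σ-inj j (λ t σt≡j → ¬hit (t , σt≡j))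
  ...   | σ′ , σ′-inj , _ = ⊥-elim (ℕ.<-irrefl ≡.refl (Fin.injective⇒≤ (λ {s} {t} → σ′-inj s t)))

  injection-misses : ∀ {l} (σ : Fin l → Fin (suc l)) → InjectiveIdx σ → ∃ λ m → ∀ t → σ t ≢ m
  injection-misses σ σ-inj with Fin.all? (λ j → Fin.any? (λ t → σ t Fin.≟ j))
  ... | yes onto = ⊥-elim (ℕ.<-irrefl ≡.refl (Fin.injective⇒≤ τ-inj))
    where
    τ-inj : ∀ {i j} → proj₁ (onto i) ≡ proj₁ (onto j) → i ≡ j
    τ-inj {i} {j} eq = ≡.trans (≡.sym (proj₂ (onto i))) (≡.trans (≡.cong σ eq) (proj₂ (onto j)))
  ... | no ¬onto with Fin.¬∀⟶∃¬ _ _ (λ j → Fin.any? (λ t → σ t Fin.≟ j)) ¬onto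
  ...   | m , ¬hit = m , λ t σt≡m → ¬hit (t , σt≡m)

  injection-misses-one : ∀ {l} (σ : Fin l → Fin (suc l)) → InjectiveIdx σ →
                         ∀ {m} → (∀ t → σ t ≢ m) → ∀ j → m ≢ j → ∃ λ t → σ t ≡ j
  injection-misses-one σ σ-inj {m} miss j m≢j with avoid⇒punchIn σ σ-inj m miss
  ... | σ′ , σ′-inj , σ′-eq with injection-surjective σ′ σ′-inj (punchOut m≢j)
  ...   | t , σ′t≡j′ =
    t , ≡.trans (≡.sym (σ′-eq t)) (≡.trans (≡.cong (punchIn m) σ′t≡j′) (Fin.punchIn-punchOut m≢j))

  kernel⇒dependent : ∀ {m n k} (A : Matrix m n) (σ : Fin k → Fin n) → InjectiveIdx σ →
                     (v : Fin n → Carrier) → InKernel A v → (∀ j → (∀ t → σ t ≢ j) → v j ≈ 0#) →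
                     ∀ t → ¬ v (σ t) ≈ 0# → ¬ LinearlyIndependent (λ t i → A i (σ t))
  kernel⇒dependent A σ σ-inj v Av≈0 v-off t vσt≉0 independent =
    vσt≉0 (independent (λ t → v (σ t)) combination≈0 t)
    where
    combination≈0 : ∀ i → ∑ (λ t → v (σ t) * A i (σ t)) ≈ 0#
    combination≈0 i = begin
      ∑ (λ t → v (σ t) * A i (σ t)) ≈⟨ ∑-injection σ σ-inj (λ s → v s * A i s)
                                         (λ j miss → trans (*-congʳ (v-off j miss)) (zeroˡ _)) ⟩
      ∑ (λ s → v s * A i s)         ≈⟨ ∑-cong (λ s → *-comm (v s) (A i s)) ⟩
      ∑ (λ s → A i s * v s)         ≈⟨ Av≈0 i ⟩
      0#                            ∎

  M₁-n-columns-dependent : ¬ 1# ≈ 0# → ∀ n (σ : Fin (suc n) → Fin (suc n)) → InjectiveIdx σ →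
                           ¬ LinearlyIndependent (λ t i → M₁ (suc n) i (σ t))
  M₁-n-columns-dependent 1≉0 n σ σ-inj =
    kernel⇒dependent (M₁ (suc n)) σ σ-inj (λ _ → 1#)
      (Δ²≈0⇒M₁-kernel (suc n) (λ _ → 1#) (λ {k} _ → Δ²-const (suc n) 1# k))
      (λ j miss → ⊥-elim (miss (proj₁ (onto j)) (proj₂ (onto j)))) zero 1≉0
    where onto = injection-surjective σ σ-inj

  -- The affine kernel vector vanishing at the column m missed by σ is 1 at the next column.
  M₁-n∸1-columns-dependent : ¬ 1# ≈ 0# → ∀ n → fromℕ (suc (suc n)) ≈ 0# →
                             (σ : Fin (suc n) → Fin (suc (suc n))) → InjectiveIdx σ →
                             ¬ LinearlyIndependent (λ t i → M₁ (suc (suc n)) i (σ t))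
  M₁-n∸1-columns-dependent 1≉0 n N≈0 σ σ-inj with injection-misses σ σ-inj
  ... | m , miss = uncurry (kernel⇒dependent (M₁ N) σ σ-inj (λ s → v (toℕ s))
                             (Δ²≈0⇒M₁-kernel N v (Δ²-affine N N≈0 (- x) 1#)) v-off)
                           hit
    where
    N = suc (suc n)
    x = fromℕ (toℕ m)
    v : ℕ → Carrier
    v k = - x + 1# * fromℕ k
    v-off : ∀ j → (∀ t → σ t ≢ j) → v (toℕ j) ≈ 0#
    v-off j j-miss with m Fin.≟ j
    ... | yes ≡.refl = solve 1 (λ x → :- x :+ ‵1 :* x := ‵0) refl x
    ... | no m≢j     = ⊥-elim (j-miss _ (proj₂ (injection-misses-one σ σ-inj miss j m≢j)))
    m⁺ : Fin N
    m⁺ = fromℕ< (next<n (Fin.toℕ<n m))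
    m≢m⁺ : m ≢ m⁺
    m≢m⁺ m≡m⁺ = next-≢ (s≤s (s≤s z≤n))
                       (≡.trans (≡.sym (Fin.toℕ-fromℕ< _)) (≡.cong toℕ (≡.sym m≡m⁺)))
    hit : ∃ λ t → ¬ v (toℕ (σ t)) ≈ 0#
    hit with injection-misses-one σ σ-inj miss m⁺ m≢m⁺
    ... | t , σt≡m⁺ = t , λ vσt≈0 → 1≉0 (begin
      1#                  ≈⟨ solve 1 (λ x → ‵1 := :- x :+ ‵1 :* (‵1 :+ x)) refl x ⟩
      - x + 1# * (1# + x) ≈⟨ +-congˡ (*-congˡ (fromℕ-next N N≈0 (toℕ m))) ⟨
      v (next N (toℕ m))  ≡⟨ ≡.cong v (≡.trans (≡.cong toℕ σt≡m⁺) (Fin.toℕ-fromℕ< _)) ⟨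
      v (toℕ (σ t))       ≈⟨ vσt≈0 ⟩
      0#                  ∎)

  -- F(k+1) = 2 F(k) - F(k-1) for k < r, started from F(-1) = F(n-1) = 0.
  linear-growth : ∀ {n r} (F : ℕ → Carrier) → r < n →
                  (∀ {k} → r ≤ k → F k ≈ 0#) → (∀ {k} → k < r → Δ² n F k ≈ 0#) →
                  ∀ {k} → k ≤ r → F k ≈ fromℕ (suc k) * F 0
  linear-growth {n} {r} F r<n F-high Δ²F≈0 = growth
    where
    next-term : ∀ {k} → suc k ≤ r → F (suc k) ≈ - (F (prev n k) + - (1# + 1#) * F k)
    next-term {k} k<r = begin
      F (suc k)                            ≡⟨ ≡.cong F (next-inner (ℕ.≤-<-trans k<r r<n)) ⟨
      F (next n k)                         ≈⟨ inverseʳ-unique _ _ (Δ²F≈0 k<r) ⟩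
      - (F (prev n k) + - (1# + 1#) * F k) ∎
    growth : ∀ {k} → k ≤ r → F k ≈ fromℕ (suc k) * F 0
    growth {zero}        _     = solve 1 (λ a → a := (‵1 :+ ‵0) :* a) refl (F 0)
    growth {suc zero}    1≤r   = begin
      F 1                                  ≈⟨ next-term 1≤r ⟩
      - (F (prev n 0) + - (1# + 1#) * F 0) ≈⟨ -‿cong (+-congʳ (F-high r≤n-1)) ⟩
      - (0# + - (1# + 1#) * F 0)           ≈⟨ solve 1 (λ a → :- (‵0 :+ :- (‵1 :+ ‵1) :* a)
                                                           := (‵1 :+ (‵1 :+ ‵0)) :* a) refl (F 0) ⟩
      fromℕ 2 * F 0                        ∎
      where r≤n-1 = ℕ.suc[m]≤n⇒m≤pred[n] r<n
    growth {suc (suc k)} k+2≤r = begin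
      F (suc (suc k))                              ≈⟨ next-term k+2≤r ⟩
      - (F k + - (1# + 1#) * F (suc k))            ≈⟨ -‿cong (+-cong (growth k≤r)
                                                                     (*-congˡ (growth k+1≤r))) ⟩
      - (x * F 0 + - (1# + 1#) * ((1# + x) * F 0)) ≈⟨ step x (F 0) ⟩
      (1# + (1# + x)) * F 0                        ∎
      where
      x = fromℕ (suc k)
      k+1≤r = ℕ.≤-trans (ℕ.n≤1+n _) k+2≤r
      k≤r = ℕ.≤-trans (ℕ.n≤1+n _) k+1≤r
      step : ∀ x a → - (x * a + - (1# + 1#) * ((1# + x) * a)) ≈ (1# + (1# + x)) * a
      step = solve 2 (λ x a → :- (x :* a :+ :- (‵1 :+ ‵1) :* ((‵1 :+ x) :* a))
                             := (‵1 :+ (‵1 :+ x)) :* a) refl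

  module _ (isField : IsField R) where

    open IsField isField

    x*y≈0⇒y≈0 : ∀ {x y} → ¬ x ≈ 0# → x * y ≈ 0# → y ≈ 0#
    x*y≈0⇒y≈0 {x} {y} x≉0 xy≈0 with inverse x x≉0
    ... | x⁻¹ , xx⁻¹≈1 = begin
      y             ≈⟨ *-identityˡ y ⟨
      1# * y        ≈⟨ *-congʳ (trans (*-comm x⁻¹ x) xx⁻¹≈1) ⟨
      (x⁻¹ * x) * y ≈⟨ *-assoc x⁻¹ x y ⟩
      x⁻¹ * (x * y) ≈⟨ *-congˡ xy≈0 ⟩
      x⁻¹ * 0#      ≈⟨ zeroʳ x⁻¹ ⟩
      0#            ∎

    first-columns-independent : ∀ {n r} (r≤n : r ≤ n) → r < n → ¬ fromℕ (suc r) ≈ 0# →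
                                LinearlyIndependent (λ t i → M₁ n i (inject≤ t r≤n))
    first-columns-independent {n} {r} r≤n r<n r+1≉0 a combination≈0 t = begin
      a t                       ≈⟨ F-inside t ⟨
      F (toℕ t)                 ≈⟨ growth (ℕ.<⇒≤ (Fin.toℕ<n t)) ⟩
      fromℕ (suc (toℕ t)) * F 0 ≈⟨ *-congˡ F0≈0 ⟩
      fromℕ (suc (toℕ t)) * 0#  ≈⟨ zeroʳ _ ⟩
      0#                        ∎
      where
      F : ℕ → Carrier
      F k with k <? r
      ... | yes k<r = a (fromℕ< k<r)
      ... | no _    = 0#
      F-inside : ∀ t → F (toℕ t) ≈ a t
      F-inside t with toℕ t <? r
      ... | yes t<r = reflexive (≡.cong a (Fin.fromℕ<-toℕ t t<r))
      ... | no t≮r  = ⊥-elim (t≮r (Fin.toℕ<n t))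
      F-outside : ∀ {k} → r ≤ k → F k ≈ 0#
      F-outside {k} r≤k with k <? r
      ... | yes k<r = ⊥-elim (ℕ.<⇒≱ k<r r≤k)
      ... | no _    = refl
      σ : Fin r → Fin n
      σ t = inject≤ t r≤n
      F-off : ∀ j → (∀ t → σ t ≢ j) → F (toℕ j) ≈ 0#
      F-off j miss with toℕ j <? r
      ... | yes j<r = ⊥-elim (miss (fromℕ< j<r) (Fin.toℕ-injective
                        (≡.trans (Fin.toℕ-inject≤ _ r≤n) (Fin.toℕ-fromℕ< j<r))))
      ... | no _    = refl
      F∈ker : InKernel (M₁ n) (λ s → F (toℕ s))
      F∈ker i = begin
        ∑ (λ s → M₁ n i s * F (toℕ s))
          ≈⟨ ∑-cong (λ s → *-comm (M₁ n i s) _) ⟩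
        ∑ (λ s → F (toℕ s) * M₁ n i s)
          ≈⟨ ∑-injection σ (Fin.inject≤-injective r≤n r≤n) (λ s → F (toℕ s) * M₁ n i s)
                         (λ j miss → trans (*-congʳ (F-off j miss)) (zeroˡ _)) ⟨
        ∑ (λ t → F (toℕ (σ t)) * M₁ n i (σ t))
          ≈⟨ ∑-cong (λ t → *-congʳ (trans (reflexive (≡.cong F (Fin.toℕ-inject≤ t r≤n)))
                                          (F-inside t))) ⟩
        ∑ (λ t → a t * M₁ n i (σ t))
          ≈⟨ combination≈0 i ⟩
        0# ∎
      growth : ∀ {k} → k ≤ r → F k ≈ fromℕ (suc k) * F 0
      growth = linear-growth F r<n F-outside (λ k<r → M₁-kernel⇒Δ²≈0 n F F∈ker (ℕ.<-trans k<r r<n))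
      F0≈0 : F 0 ≈ 0#
      F0≈0 = x*y≈0⇒y≈0 r+1≉0 (trans (sym (growth ℕ.≤-refl)) (F-outside ℕ.≤-refl))

    M₁-principal-reduction :
      ∀ {n r} (r≤n : r ≤ n) → r < n → ¬ fromℕ (suc r) ≈ 0# →
      ((σ : Fin (suc r) → Fin n) → InjectiveIdx σ → ¬ LinearlyIndependent (λ t i → M₁ n i (σ t))) →
      (κ : Fin n → Fin n → Carrier) →
      (∀ j s → r ≤ toℕ j → r ≤ toℕ s → κ j s ≈ Id s j) →
      (∀ j → r ≤ toℕ j → InKernel (M₁ n) (κ j)) →
        HasRank (M₁ n) r
      × IsReducedMatrix (M₁ n) (principal r≤n (M₁ n))
      × det (principal r≤n (M₁ n)) ≈ ((- 1#) ^ᶠ r) * fromℕ (suc r)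
    M₁-principal-reduction {n} {r} r≤n r<n r+1≉0 dependent κ κ-tail κ-ker =
        (first-columns , dependent)
      , (Congruence.equivalent-principal r≤n (M₁ n) (M₁-sym n) κ κ-tail κ-ker
        , nonsingular-by-det (principal r≤n (M₁ n)) r det≈ r+1≉0)
      , det≈
      where
      first-columns : Σ (Fin r → Fin n) λ σ →
                      InjectiveIdx σ × LinearlyIndependent (λ t i → M₁ n i (σ t))
      first-columns = (λ t → inject≤ t r≤n) , Fin.inject≤-injective r≤n r≤n
                    , first-columns-independent r≤n r<n r+1≉0
      det≈ : det (principal r≤n (M₁ n)) ≈ ((- 1#) ^ᶠ r) * fromℕ (suc r)
      det≈ = trans (det-cong (principal-M₁ r≤n r<n)) (det-Tridiagonal r)

    coprime-case : ∀ n → 1 ≤ n → ¬ fromℕ n ≈ 0# →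
        HasRank (M₁ n) (n ∸ 1)
      × IsReducedMatrix (M₁ n) (principal (m∸n≤m n 1) (M₁ n))
      × det (principal (m∸n≤m n 1) (M₁ n)) ≈ ((- 1#) ^ᶠ (n ∸ 1)) * fromℕ n
    coprime-case (suc r) _ n≉0 =
      M₁-principal-reduction (ℕ.n≤1+n r) ℕ.≤-refl n≉0 (M₁-n-columns-dependent 1≉0 r)
        (λ _ _ → 1#) tail (λ _ _ → Δ²≈0⇒M₁-kernel (suc r) _ (λ {k} _ → Δ²-const (suc r) 1# k))
      where
      last : ∀ (i : Fin (suc r)) → r ≤ toℕ i → toℕ i ≡ r
      last i r≤i = ℕ.≤-antisym (ℕ.s≤s⁻¹ (Fin.toℕ<n i)) r≤i
      tail : ∀ j s → r ≤ toℕ j → r ≤ toℕ s → 1# ≈ Id s j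
      tail j s r≤j r≤s = sym (reflexive (≡.trans (Id≡δ s j)
                                (≡.trans (≡.cong₂ δ (last s r≤s) (last j r≤j)) (δ-refl r))))

    -- The kernel vectors -1 - k and 2 + k restrict to the unit vectors at k = r, r + 1
    -- modulo n = r + 2.
    divisible-case : ∀ n → 3 ≤ n → fromℕ n ≈ 0# →
        HasRank (M₁ n) (n ∸ 2)
      × IsReducedMatrix (M₁ n) (principal (m∸n≤m n 2) (M₁ n))
      × det (principal (m∸n≤m n 2) (M₁ n)) ≈ (- 1#) ^ᶠ (n ∸ 1)
    divisible-case (suc (suc (suc r′))) (s≤s (s≤s (s≤s _))) n≈0 =
      adjust-det (M₁-principal-reduction r≤n (ℕ.m<n⇒m<1+n (ℕ.n<1+n r)) r+1≉0
                   (M₁-n∸1-columns-dependent 1≉0 r n≈0) κ tail (λ j _ → κ-ker j))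
      where
      r = suc r′
      N = suc (suc r)
      r≤n : r ≤ N
      r≤n = ℕ.≤-trans (ℕ.n≤1+n r) (ℕ.n≤1+n (suc r))
      r+1≈-1 : fromℕ (suc r) ≈ - 1#
      r+1≈-1 = inverseʳ-unique 1# (fromℕ (suc r)) n≈0
      r+1≉0 : ¬ fromℕ (suc r) ≈ 0#
      r+1≉0 r+1≈0 =
        1≉0 (trans (sym (-‿involutive 1#)) (trans (-‿cong (trans (sym r+1≈-1) r+1≈0)) -0#≈0#))
      column : ℕ → ℕ → Carrier
      column c k = if c ≡ᵇ r then - 1# + - 1# * fromℕ k else (1# + 1#) + 1# * fromℕ k
      κ : Fin N → Fin N → Carrier
      κ j s = column (toℕ j) (toℕ s)
      κ-ker : ∀ j → InKernel (M₁ N) (κ j)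
      κ-ker j with toℕ j ≡ᵇ r
      ... | true  = Δ²≈0⇒M₁-kernel N _ (Δ²-affine N n≈0 (- 1#) (- 1#))
      ... | false = Δ²≈0⇒M₁-kernel N _ (Δ²-affine N n≈0 (1# + 1#) 1#)
      mod-N : ∀ {a b} c → a ≈ b + c * fromℕ N → a ≈ b
      mod-N c a≈ = trans a≈ (trans (+-congˡ (trans (*-congˡ n≈0) (zeroʳ c))) (+-identityʳ _))
      last-two : ∀ (i : Fin N) → r ≤ toℕ i → toℕ i ≡ r ⊎ toℕ i ≡ suc r
      last-two i r≤i with ℕ.m<1+n⇒m<n∨m≡n (Fin.toℕ<n i)
      ... | inj₁ i<r+1 = inj₁ (ℕ.≤-antisym (ℕ.s≤s⁻¹ i<r+1) r≤i)
      ... | inj₂ i≡r+1 = inj₂ i≡r+1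
      column-tail : ∀ c k → c ≡ r ⊎ c ≡ suc r → k ≡ r ⊎ k ≡ suc r → column c k ≈ δ k c
      column-tail _ _ (inj₁ ≡.refl) (inj₁ ≡.refl)
        rewrite ≡ᵇ-refl r = mod-N (- 1#) (solve 1 (λ y →
          :- ‵1 :+ :- ‵1 :* y := ‵1 :+ :- ‵1 :* (‵1 :+ (‵1 :+ y))) refl (fromℕ r))
      column-tail _ _ (inj₁ ≡.refl) (inj₂ ≡.refl)
        rewrite ≡ᵇ-refl r | δ-≢ (ℕ.1+n≢n {r}) = mod-N (- 1#) (solve 1 (λ y →
          :- ‵1 :+ :- ‵1 :* (‵1 :+ y) := ‵0 :+ :- ‵1 :* (‵1 :+ (‵1 :+ y))) refl (fromℕ r))
      column-tail _ _ (inj₂ ≡.refl) (inj₁ ≡.refl)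
        rewrite ≢⇒≡ᵇ-false (ℕ.1+n≢n {r}) | δ-≢ (ℕ.1+n≢n {r} ∘ ≡.sym) = mod-N 1# (solve 1 (λ y →
          (‵1 :+ ‵1) :+ ‵1 :* y := ‵0 :+ ‵1 :* (‵1 :+ (‵1 :+ y))) refl (fromℕ r))
      column-tail _ _ (inj₂ ≡.refl) (inj₂ ≡.refl)
        rewrite ≢⇒≡ᵇ-false (ℕ.1+n≢n {r}) | ≡ᵇ-refl r = mod-N 1# (solve 1 (λ y →
          (‵1 :+ ‵1) :+ ‵1 :* (‵1 :+ y) := ‵1 :+ ‵1 :* (‵1 :+ (‵1 :+ y))) refl (fromℕ r))
      tail : ∀ j s → r ≤ toℕ j → r ≤ toℕ s → κ j s ≈ Id s j
      tail j s r≤j r≤s = trans (column-tail (toℕ j) (toℕ s) (last-two j r≤j) (last-two s r≤s))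
                               (reflexive (≡.sym (Id≡δ s j)))
      adjust-det : ∀ {A B} → A × B × det (principal r≤n (M₁ N)) ≈ ((- 1#) ^ᶠ r) * fromℕ (suc r) →
                   A × B × det (principal r≤n (M₁ N)) ≈ (- 1#) ^ᶠ suc r
      adjust-det (rank , reduced , det≈) = rank , reduced , trans det≈ (trans (*-congˡ r+1≈-1)
        (solve 1 (λ s → s :* :- ‵1 := :- ‵1 :* s) refl _))

    coprime⇒fromℕ≉0 : ∀ n p → gcd n p ≡ 1 → fromℕ p ≈ 0# → ¬ fromℕ n ≈ 0#
    coprime⇒fromℕ≉0 n p gcd≡1 p≈0 n≈0 with coprime-Bézout (gcd≡1⇒coprime gcd≡1)
    ... | Bézout.+- x y eq = 1≉0 (trans (sym (fromℕ-1+*-zeroʳ y p p≈0))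
                                        (trans (reflexive (≡.cong fromℕ eq)) (fromℕ-*-zeroʳ x n n≈0)))
    ... | Bézout.-+ x y eq = 1≉0 (trans (sym (fromℕ-1+*-zeroʳ x n n≈0))
                                        (trans (reflexive (≡.cong fromℕ eq)) (fromℕ-*-zeroʳ y p p≈0)))

-- Only the characteristic p of the field matters.
proposition3p3 : ∀ {c ℓ} (R : CommutativeRing c ℓ) (p k q : ℕ)
    → Prime p → p ≢ 2 → 1 ≤ k → q ≡ p ^ k
    → IsField R → HasCardinality R q
    → CommutativeRing._≈_ R (MatrixDefs.fromℕ R p) (CommutativeRing.0# R)
    → (n : ℕ) → 1 ≤ n
    → let open CommutativeRing R hiding (zero)
          open MatrixDefs R
      in (gcd n p ≡ 1 →
            HasRank (M₁ n) (n ∸ 1)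
            × IsReducedMatrix (M₁ n) (principal (m∸n≤m n 1) (M₁ n))
            × det (principal (m∸n≤m n 1) (M₁ n)) ≈ ((- 1#) ^ᶠ (n ∸ 1)) * fromℕ n)
       × (gcd n p ≡ p →
            HasRank (M₁ n) (n ∸ 2)
            × IsReducedMatrix (M₁ n) (principal (m∸n≤m n 2) (M₁ n))
            × det (principal (m∸n≤m n 2) (M₁ n)) ≈ (- 1#) ^ᶠ (n ∸ 1))
proposition3p3 R p _ _ p-prime p≢2 _ _ isField _ p≈0 n 1≤n =
    (λ gcd≡1 → coprime-case isField n 1≤n (coprime⇒fromℕ≉0 isField n p gcd≡1 p≈0))
  , (λ gcd≡p → divisible-case isField n (3≤n gcd≡p) (∣⇒fromℕ≈0 (p∣n gcd≡p) p≈0))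
  where
  open CycleSecondDifference R
  p∣n : gcd n p ≡ p → p ∣ n
  p∣n gcd≡p = ≡.subst (_∣ n) gcd≡p (gcd[m,n]∣m n p)
  3≤p : 3 ≤ p
  3≤p = ℕ.≤∧≢⇒< (ℕ.nonTrivial⇒n>1 p {{prime⇒nonTrivial p-prime}}) (p≢2 ∘ ≡.sym)
  3≤n : gcd n p ≡ p → 3 ≤ n
  3≤n gcd≡p = ℕ.≤-trans 3≤p (∣⇒≤ {{ℕ.>-nonZero 1≤n}} (p∣n gcd≡p))
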